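{- Let $v\in I(d)$ and let $C$ be a $v$-chain. Then the multiset $S_C$ has no repeated elements and is a distinguished subset of $N_v$.
   Context: $k^*:=2d+1-k$; $I(d)$ is the set of $d$-element subsets of $\{1,\dots,2d\}$ containing exactly one of $k,k^*$ for each $k$ and having an even number of entries exceeding $d$. $R_v=\{(r,c):r\notin v,\ c\in v\}$, $N_v=\{(r,c)\in R_v:r>c\}$, $OR_v=\{(r,c)\in R_v:r<c^*\}$, $ON_v=N_v\cap OR_v$. $(R,C)>(r,c)$ means $R>r$ and $C<c$; a $v$-chain is a sequence $\alpha_1>\dots>\alpha_\ell$ of elements of $ON_v$. For $\alpha=(r,c)$: $p_v(\alpha)=(c^*,c)$, $p_h(\alpha)=(r,r^*)$, $\alpha^\#=(c^*,r^*)$. Consecutive elements $\alpha_j=(r_j,c_j)$, $\alpha_{j+1}=(r_{j+1},c_{j+1})$ are connected if $r_j\le c_{j+1}^*$ and $r_{j+1}>r_j^*$; connected components are the classes of the generated equivalence relation. For a connected $v$-chain $\alpha_1>\dots>\alpha_\ell$ with $\alpha_\ell=(r_\ell,c_\ell)$, $S_C$ is the multiset $\{p_v(\alpha_1),\dots,p_v(\alpha_\ell)\}$ if $\ell$ even; $\{p_v(\alpha_1),\dots,p_v(\alpha_\ell),p_h(\alpha_\ell)\}$ if $\ell$ odd and $r_\ell>r_\ell^*$; $\{p_v(\alpha_1),\dots,p_v(\alpha_{\ell-1}),\alpha_\ell,\alpha_\ell^\#\}$ if $\ell$ odd and $r_\ell<r_\ell^*$; for a general $v$-chain, $S_C$ is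 the multiset union over its connected components. A subset $S\subseteq N_v$ is distinguished if for any two distinct $(R,C),(r,c)\in S$: (A) $R\neq r$ and $C\neq c$; (B) if $R>r$ then $r<C$ or $C<c$. -}

module Defs where

open import Data.Bool using (Bool; true; false; if_then_else_; _∧_)
open import Data.Nat using (ℕ; zero; suc; _+_; _*_; _∸_; _≤_; _<_; _≤ᵇ_; _<ᵇ_)
open import Data.Nat.Divisibility using (_∣_)
open import Data.Nat.Properties using (_<?_)
open import Data.Product using (_×_; _,_)
open import Data.Sum using (_⊎_)
open import Data.List using (List; []; _∷_; length; filter; map; reverse; concatMap)
open import Data.List.Membership.Propositional using (_∈_; _∉_)
open import Data.List.Relation.Unary.All using (All)
open import Data.List.Relation.Unary.Unique.Propositional using (Unique)
open import Data.List.Relation.Unary.Linked using (Linked)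
open import Relation.Binary.PropositionalEquality using (_≡_; _≢_)

-- Positions (r , c) with r, c ∈ {1, …, 2d}.
Pos : Set
Pos = ℕ × ℕ

star : ℕ → ℕ → ℕ
star d k = (2 * d + 1) ∸ k

InRange : ℕ → ℕ → Set
InRange d k = 1 ≤ k × k ≤ 2 * d

InI : (d : ℕ) → List ℕ → Set
InI d v =
  length v ≡ d
  × Unique v
  × All (InRange d) v
  × (∀ k → InRange d k → (k ∈ v × star d k ∉ v) ⊎ (k ∉ v × star d k ∈ v))
  × 2 ∣ length (filter (d <?_) v)

InR : ℕ → List ℕ → Pos → Set
InR d v (r , c) = InRange d r × InRange d c × r ∉ v × c ∈ v

InN : ℕ → List ℕ → Pos → Set
InN d v (r , c) = InR d v (r , c) × c < r

InOR : ℕ → List ℕ → Pos → Set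
InOR d v (r , c) = InR d v (r , c) × r < star d c

InON : ℕ → List ℕ → Pos → Set
InON d v α = InN d v α × InOR d v α

_≻_ : Pos → Pos → Set
(R , C) ≻ (r , c) = r < R × C < c

IsChain : ℕ → List ℕ → List Pos → Set
IsChain d v C = All (InON d v) C × Linked _≻_ C

pv : ℕ → Pos → Pos
pv d (r , c) = (star d c , c)

ph : ℕ → Pos → Pos
ph d (r , c) = (r , star d r)

sharp : ℕ → Pos → Pos
sharp d (r , c) = (star d c , star d r)

connected : ℕ → Pos → Pos → Bool
connected d (r , c) (r' , c') = (r ≤ᵇ star d c') ∧ (star d r <ᵇ r')

components-go : ℕ → Pos → List Pos → List Pos → List (List Pos)
components-go d last acc [] = reverse (last ∷ acc) ∷ []
components-go d last acc (y ∷ ys) =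
  if connected d last y
  then components-go d y (last ∷ acc) ys
  else reverse (last ∷ acc) ∷ components-go d y [] ys

components : ℕ → List Pos → List (List Pos)
components d [] = []
components d (x ∷ xs) = components-go d x [] xs

isEven : ℕ → Bool
isEven zero = true
isEven (suc n) = if isEven n then false else true

S-odd : ℕ → List Pos → List Pos
S-odd d [] = []
S-odd d ((r , c) ∷ []) =
  if star d r <ᵇ r
  then pv d (r , c) ∷ ph d (r , c) ∷ []
  else (r , c) ∷ sharp d (r , c) ∷ []
S-odd d (x ∷ y ∷ xs) = pv d x ∷ S-odd d (y ∷ xs)

S-connected : ℕ → List Pos → List Pos
S-connected d b = if isEven (length b) then map (pv d) b else S-odd d b

S : ℕ → List Pos → List Pos
S d C = concatMap (S-connected d) (components d C)

Distinguished : ℕ → List ℕ → List Pos → Set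
Distinguished d v T =
  All (InN d v) T
  × (∀ {R C r c} → (R , C) ∈ T → (r , c) ∈ T → (R , C) ≢ (r , c) →
       (R ≢ r × C ≢ c) × (r < R → r < C ⊎ C < c))

-- Flag each entry of the chain by whether it ends a connected component of odd
-- length.  Then S_C is the concatenation of one contribution per entry: p_v(α)
-- for an unflagged entry, and {p_v(α), p_h(α)} or {α, α#} for a flagged one,
-- according as r* < r or r < r*.  All these points lie in N_v, and any two of
-- them satisfy (A) and (B) in both orders.  Across entries α ≻ β, rows decrease and columns increase along the
-- chain, which separates p_v(α) from the points of β; for p_h(α) one uses that a
-- flagged α is not connected to its successor, which for entries of ON_v means
-- r' < r* or r* < c', a condition that persists along the chain.  An entry with
-- r < r* is never connected to its successor, and its successors again satisfy
-- r < r*, so every later entry is flagged; this separates {α, α#} from them.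

module Submission where

open import Defs
open import Data.Bool using (Bool; true; false; if_then_else_; not; T)
open import Data.Empty using (⊥-elim)
open import Data.List using (List; []; _∷_; _++_; length; map; reverse; concatMap)
open import Data.List.Properties
  using (unfold-reverse; length-++; length-reverse; ++-assoc; ++-identityʳ; map-++)
open import Data.List.Membership.Propositional using (_∈_; _∉_)
open import Data.List.Relation.Unary.Any using (here; there)
open import Data.List.Relation.Unary.All as All using (All; []; _∷_)
import Data.List.Relation.Unary.All.Properties as Allₚ
open import Data.List.Relation.Unary.AllPairs as AllPairs using (AllPairs; []; _∷_)
import Data.List.Relation.Unary.AllPairs.Properties as AllPairsₚ
open import Data.List.Relation.Unary.Linked.Properties using (Linked⇒AllPairs)
open import Data.List.Relation.Unary.Unique.Propositional using (Unique)
open import Data.Nat using (ℕ; suc; _+_; _*_; _≤_; _<_; _≤ᵇ_; _<ᵇ_; z≤n; s≤s)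
open import Data.Nat.Properties
open import Data.Product using (_×_; _,_; proj₁; proj₂)
open import Data.Sum using (_⊎_; inj₁; inj₂)
open import Data.Unit using (tt)
open import Function using (_∘_)
open import Level using (0ℓ)
open import Relation.Binary.Core using (Rel)
open import Relation.Binary.Definitions using (Symmetric)
open import Relation.Binary.PropositionalEquality
open import Relation.Nullary.Reflects using (ofʸ; ofⁿ)
open import Relation.Unary using (Pred)

∉-∈⇒≢ : ∀ {A : Set} {x y : A} {xs : List A} → x ∉ xs → y ∈ xs → x ≢ y
∉-∈⇒≢ x∉ y∈ refl = x∉ y∈

AllPairs-lookup : ∀ {A : Set} {R : Rel A 0ℓ} {xs x y} → Symmetric R →
  AllPairs R xs → x ∈ xs → y ∈ xs → x ≢ y → R x y
AllPairs-lookup R-sym (_ ∷ _) (here refl) (here refl) x≢y = ⊥-elim (x≢y refl)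
AllPairs-lookup R-sym (r ∷ _) (here refl) (there y∈) _ = All.lookup r y∈
AllPairs-lookup R-sym (r ∷ _) (there x∈) (here refl) _ = R-sym (All.lookup r x∈)
AllPairs-lookup R-sym (_ ∷ rs) (there x∈) (there y∈) x≢y = AllPairs-lookup R-sym rs x∈ y∈ x≢y

module _ {A B : Set} {P : Pred A 0ℓ} {S : Rel A 0ℓ} {R : Rel B 0ℓ} {f : A → List B}
  (internal : ∀ {x} → P x → AllPairs R (f x))
  (across : ∀ {x y} → P x → P y → S x y → All (λ a → All (R a) (f y)) (f x)) where

  concatMap⁺ : ∀ {xs} → All P xs → AllPairs S xs → AllPairs R (concatMap f xs)
  concatMap⁺ ps ss =
    AllPairsₚ.concat⁺ (Allₚ.map⁺ (All.map internal ps)) (AllPairsₚ.map⁺ (across⁺ ps ss))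
    where
    across⁺ : ∀ {xs} → All P xs → AllPairs S xs →
      AllPairs (λ x y → All (λ a → All (R a) (f y)) (f x)) xs
    across⁺ [] [] = []
    across⁺ (p ∷ ps) (s ∷ ss) = All.zipWith (λ (q , t) → across p q t) (ps , s) ∷ across⁺ ps ss

≻-trans : ∀ {a b c} → a ≻ b → b ≻ c → a ≻ c
≻-trans {_ , _} {_ , _} {_ , _} (b₁<a₁ , a₂<b₂) (c₁<b₁ , b₂<c₂) =
  <-trans c₁<b₁ b₁<a₁ , <-trans a₂<b₂ b₂<c₂

Separated : Pos → Pos → Set
Separated (R , C) (r , c) =
  (R ≢ r × C ≢ c) × (r < R → r < C ⊎ C < c) × (R < r → R < c ⊎ c < C)

AllSeparated : List Pos → List Pos → Set
AllSeparated xs ys = All (λ a → All (Separated a) ys) xs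

separated-sym : Symmetric Separated
separated-sym {_ , _} {_ , _} ((R≢r , C≢c) , below , above) = (≢-sym R≢r , ≢-sym C≢c) , above , below

separated⇒≢ : ∀ {a b} → Separated a b → a ≢ b
separated⇒≢ {_ , _} {_ , _} ((R≢r , _) , _) = R≢r ∘ cong proj₁

≻⇒separated : ∀ {a b} → a ≻ b → Separated a b
≻⇒separated {_ , _} {_ , _} (r<R , C<c) =
  (>⇒≢ r<R , <⇒≢ C<c) , (λ _ → inj₂ C<c) , (λ R<r → ⊥-elim (<-asym r<R R<r))

≺⇒separated : ∀ {a b} → b ≻ a → Separated a b
≺⇒separated = separated-sym ∘ ≻⇒separated

dominates⇒separated : ∀ {R C r c} → r < R → c < C → r < C → Separated (R , C) (r , c)
dominates⇒separated r<R c<C r<C =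
  (>⇒≢ r<R , >⇒≢ c<C) , (λ _ → inj₁ r<C) , (λ R<r → ⊥-elim (<-asym r<R R<r))

dominated⇒separated : ∀ {R C r c} → R < r → C < c → R < c → Separated (R , C) (r , c)
dominated⇒separated R<r C<c R<c = separated-sym (dominates⇒separated R<r C<c R<c)

module _ (d : ℕ) where

  oddEnd : Pos → List Pos
  oddEnd α = S-odd d (α ∷ [])

  contribution : Pos × Bool → List Pos
  contribution (α , false) = pv d α ∷ []
  contribution (α , true) = oddEnd α

  -- The Bool argument is true iff the current entry has odd position
  -- (first, third, …) in its connected component.
  markOddEnds : Pos → Bool → List Pos → List (Pos × Bool)
  markOddEnds α odd [] = (α , odd) ∷ []
  markOddEnds α odd (β ∷ βs) =
    if connected d α β
    then (α , false) ∷ markOddEnds β (not odd) βs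
    else (α , odd) ∷ markOddEnds β true βs

  markOddEnds-All : ∀ {P : Pos × Bool → Set} α b βs →
    All (λ γ → ∀ u → P (γ , u)) (α ∷ βs) → All P (markOddEnds α b βs)
  markOddEnds-All α b [] (p ∷ []) = p b ∷ []
  markOddEnds-All α b (β ∷ βs) (p ∷ ps) with connected d α β
  ... | true = p false ∷ markOddEnds-All β (not b) βs ps
  ... | false = p b ∷ markOddEnds-All β true βs ps

  S-odd-∷ʳ : ∀ xs z → S-odd d (xs ++ z ∷ []) ≡ map (pv d) xs ++ oddEnd z
  S-odd-∷ʳ [] z = refl
  S-odd-∷ʳ (x ∷ []) z = refl
  S-odd-∷ʳ (x ∷ y ∷ xs) z = cong (pv d x ∷_) (S-odd-∷ʳ (y ∷ xs) z)

  isEven-suc : ∀ n → isEven (suc n) ≡ not (isEven n)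
  isEven-suc n with isEven n
  ... | true = refl
  ... | false = refl

  map-pv-reverse : ∀ z acc → map (pv d) (reverse (z ∷ acc)) ≡ map (pv d) (reverse acc) ++ pv d z ∷ []
  map-pv-reverse z acc rewrite unfold-reverse z acc = map-++ (pv d) (reverse acc) (z ∷ [])

  S-connected-reverse : ∀ z acc →
    S-connected d (reverse (z ∷ acc)) ≡ map (pv d) (reverse acc) ++ contribution (z , isEven (length acc))
  S-connected-reverse z acc
    rewrite unfold-reverse z acc | length-++ (reverse acc) {z ∷ []} | length-reverse acc
          | +-comm (length acc) 1 | isEven-suc (length acc)
    with isEven (length acc)
  ... | true = S-odd-∷ʳ (reverse acc) z
  ... | false = map-++ (pv d) (reverse acc) (z ∷ [])

  concatMap-components-go : ∀ α acc βs →
    concatMap (S-connected d) (components-go d α acc βs)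
      ≡ map (pv d) (reverse acc) ++ concatMap contribution (markOddEnds α (isEven (length acc)) βs)
  concatMap-components-go α acc [] =
    trans (++-identityʳ _)
      (trans (S-connected-reverse α acc) (cong (map (pv d) (reverse acc) ++_) (sym (++-identityʳ _))))
  concatMap-components-go α acc (β ∷ βs) with connected d α β
  ... | true =
    begin
      concatMap (S-connected d) (components-go d β (α ∷ acc) βs)
    ≡⟨ concatMap-components-go β (α ∷ acc) βs ⟩
      map (pv d) (reverse (α ∷ acc)) ++ rest (isEven (suc (length acc)))
    ≡⟨ cong₂ _++_ (map-pv-reverse α acc) (cong rest (isEven-suc (length acc))) ⟩
      (map (pv d) (reverse acc) ++ pv d α ∷ []) ++ rest (not (isEven (length acc)))
    ≡⟨ ++-assoc (map (pv d) (reverse acc)) _ _ ⟩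
      map (pv d) (reverse acc) ++ pv d α ∷ rest (not (isEven (length acc)))
    ∎
    where
    open ≡-Reasoning
    rest : Bool → List Pos
    rest b = concatMap contribution (markOddEnds β b βs)
  ... | false =
    trans (cong (_++ _) (S-connected-reverse α acc))
      (trans (cong (_ ++_) (concatMap-components-go β [] βs))
        (++-assoc (map (pv d) (reverse acc)) _ _))

  S≡concatMap-contribution : ∀ α βs → S d (α ∷ βs) ≡ concatMap contribution (markOddEnds α true βs)
  S≡concatMap-contribution α βs = concatMap-components-go α [] βs

  infix 10 _⋆
  _⋆ : ℕ → ℕ
  k ⋆ = star d k

  inRange⇒≤ : ∀ {k} → InRange d k → k ≤ 2 * d + 1
  inRange⇒≤ (_ , k≤2d) = ≤-trans k≤2d (m≤m+n (2 * d) 1)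

  ⋆-inRange : ∀ {k} → InRange d k → InRange d (k ⋆)
  ⋆-inRange (1≤k , k≤2d) =
    m<n⇒0<n∸m (≤-<-trans k≤2d (m<m+n (2 * d) (s≤s z≤n))) ,
    ≤-trans (∸-monoʳ-≤ (2 * d + 1) 1≤k) (≤-reflexive (m+n∸n≡m (2 * d) 1))

  ⋆-antitone : ∀ {x y} → x < y → InRange d y → y ⋆ < x ⋆
  ⋆-antitone x<y y∈ = ∸-monoʳ-< x<y (inRange⇒≤ y∈)

  ⋆-involutive : ∀ {x} → InRange d x → x ⋆ ⋆ ≡ x
  ⋆-involutive x∈ = m∸[m∸n]≡n (inRange⇒≤ x∈)

  <⋆-swap : ∀ {x y} → x < y ⋆ → InRange d y → y < x ⋆
  <⋆-swap {x} x<y⋆ y∈ = subst (_< x ⋆) (⋆-involutive y∈) (⋆-antitone x<y⋆ (⋆-inRange y∈))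

  ⋆<-swap : ∀ {x y} → x ⋆ < y → InRange d x → InRange d y → y ⋆ < x
  ⋆<-swap {x} {y} x⋆<y x∈ y∈ = subst (y ⋆ <_) (⋆-involutive x∈) (⋆-antitone x⋆<y y∈)

  Low : Pos → Set
  Low (r , _) = r < r ⋆

  Disconnected : Pos → Pos → Set
  Disconnected (r , _) (r' , c') = r' < r ⋆ ⊎ r ⋆ < c'

  disconnected-≻ : ∀ {α β γ} → Disconnected α β → β ≻ γ → Disconnected α γ
  disconnected-≻ {_ , _} {_ , _} {_ , _} (inj₁ r'<r⋆) (r''<r' , _) = inj₁ (<-trans r''<r' r'<r⋆)
  disconnected-≻ {_ , _} {_ , _} {_ , _} (inj₂ r⋆<c') (_ , c'<c'') = inj₂ (<-trans r⋆<c' c'<c'')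

  connected⇒⋆< : ∀ {r c r' c'} → connected d (r , c) (r' , c') ≡ true → r ⋆ < r'
  connected⇒⋆< {r} {_} {r'} {c'} eq with r ≤ᵇ c' ⋆ | r ⋆ <ᵇ r' | <ᵇ-reflects-< (r ⋆) r'
  connected⇒⋆< refl | true | true | ofʸ r⋆<r' = r⋆<r'

  Compatible : Pos × Bool → Pos × Bool → Set
  Compatible (α , t) (β , u) = α ≻ β × (T t → Disconnected α β) × (T t → Low α → T u)

  module _ (v : List ℕ)
    (complementary : ∀ k → InRange d k → (k ∈ v × star d k ∉ v) ⊎ (k ∉ v × star d k ∈ v)) where

    ∈v⇒⋆∉v : ∀ {k} → InRange d k → k ∈ v → k ⋆ ∉ v
    ∈v⇒⋆∉v {k} k∈ k∈v with complementary k k∈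
    ... | inj₁ (_ , k⋆∉v) = k⋆∉v
    ... | inj₂ (k∉v , _) = ⊥-elim (k∉v k∈v)

    ∉v⇒⋆∈v : ∀ {k} → InRange d k → k ∉ v → k ⋆ ∈ v
    ∉v⇒⋆∈v {k} k∈ k∉v with complementary k k∈
    ... | inj₁ (k∈v , _) = ⊥-elim (k∉v k∈v)
    ... | inj₂ (_ , k⋆∈v) = k⋆∈v

    record ON (r c : ℕ) : Set where
      field
        r-range : InRange d r
        c-range : InRange d c
        r∉v : r ∉ v
        c∈v : c ∈ v
        c<r : c < r
        r<c⋆ : r < c ⋆

      r⋆∈v : r ⋆ ∈ v
      r⋆∈v = ∉v⇒⋆∈v r-range r∉v

      c⋆∉v : c ⋆ ∉ v
      c⋆∉v = ∈v⇒⋆∉v c-range c∈v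

    open ON

    toON : ∀ {r c} → InON d v (r , c) → ON r c
    toON (((r-range , c-range , r∉v , c∈v) , c<r) , (_ , r<c⋆)) =
      record { r-range = r-range ; c-range = c-range ; r∉v = r∉v ; c∈v = c∈v ; c<r = c<r ; r<c⋆ = r<c⋆ }

    low-≻ : ∀ {r c β} → ON r c → (r , c) ≻ β → Low (r , c) → Low β
    low-≻ {β = _ , _} o (r'<r , _) r<r⋆ = <-trans r'<r (<-trans r<r⋆ (⋆-antitone r'<r (r-range o)))

    ¬connected⇒disconnected : ∀ {r c r' c'} → ON r c → ON r' c' →
      connected d (r , c) (r' , c') ≡ false → Disconnected (r , c) (r' , c')
    ¬connected⇒disconnected {r} {_} {r'} {c'} oα oβ eq
      with r ≤ᵇ c' ⋆ | ≤ᵇ-reflects-≤ r (c' ⋆) | r ⋆ <ᵇ r' | <ᵇ-reflects-< (r ⋆) r'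
    ... | false | ofⁿ r≰c'⋆ | _ | _ = inj₂ (⋆<-swap (≰⇒> r≰c'⋆) (c-range oβ) (r-range oα))
    ... | true | _ | false | ofⁿ r⋆≮r' =
      inj₁ (≤∧≢⇒< (≮⇒≥ r⋆≮r') (∉-∈⇒≢ (r∉v oβ) (r⋆∈v oα)))

    data OddEndView (r c : ℕ) : List Pos → Set where
      high : r ⋆ < r → OddEndView r c (pv d (r , c) ∷ ph d (r , c) ∷ [])
      low : r < r ⋆ → OddEndView r c ((r , c) ∷ sharp d (r , c) ∷ [])

    oddEnd-view : ∀ {r c} → ON r c → OddEndView r c (oddEnd (r , c))
    oddEnd-view {r} o with r ⋆ <ᵇ r | <ᵇ-reflects-< (r ⋆) r
    ... | true | ofʸ r⋆<r = high r⋆<r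
    ... | false | ofⁿ r⋆≮r = low (≤∧≢⇒< (≮⇒≥ r⋆≮r) (∉-∈⇒≢ (r∉v o) (r⋆∈v o)))

    data ContributionView (r c : ℕ) : List Pos → Set where
      vertical : ContributionView r c (pv d (r , c) ∷ [])
      odd-end : ∀ {L} → OddEndView r c L → ContributionView r c L

    contribution-view : ∀ {r c} → ON r c → ∀ u → ContributionView r c (contribution ((r , c) , u))
    contribution-view o false = vertical
    contribution-view o true = odd-end (oddEnd-view o)

    pv-inN : ∀ {r c} → ON r c → InN d v (pv d (r , c))
    pv-inN o = (⋆-inRange (c-range o) , c-range o , c⋆∉v o , c∈v o) , <-trans (c<r o) (r<c⋆ o)

    contribution-inN : ∀ {r c} → ON r c → ∀ u → All (InN d v) (contribution ((r , c) , u))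
    contribution-inN {r} {c} o u = inN (contribution-view o u)
      where
      inN : ∀ {L} → ContributionView r c L → All (InN d v) L
      inN vertical = pv-inN o ∷ []
      inN (odd-end (high r⋆<r)) =
        pv-inN o ∷ ((r-range o , ⋆-inRange (r-range o) , r∉v o , r⋆∈v o) , r⋆<r) ∷ []
      inN (odd-end (low _)) =
        ((r-range o , c-range o , r∉v o , c∈v o) , c<r o)
        ∷ ((⋆-inRange (c-range o) , ⋆-inRange (r-range o) , c⋆∉v o , r⋆∈v o) ,
           ⋆-antitone (c<r o) (r-range o))
        ∷ []

    contribution-separated : ∀ {r c} → ON r c → ∀ u → AllPairs Separated (contribution ((r , c) , u))
    contribution-separated {r} {c} o u = separated (contribution-view o u)
      where
      c<r⋆ : c < r ⋆
      c<r⋆ = <⋆-swap (r<c⋆ o) (c-range o)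
      separated : ∀ {L} → ContributionView r c L → AllPairs Separated L
      separated vertical = [] ∷ []
      separated (odd-end (high _)) = (≻⇒separated (r<c⋆ o , c<r⋆) ∷ []) ∷ [] ∷ []
      separated (odd-end (low r<r⋆)) = (dominated⇒separated (r<c⋆ o) c<r⋆ r<r⋆ ∷ []) ∷ [] ∷ []

    module _ {r c r' c'} (oα : ON r c) (oβ : ON r' c') (r'<r : r' < r) (c<c' : c < c') where

      c'⋆<c⋆ : c' ⋆ < c ⋆
      c'⋆<c⋆ = ⋆-antitone c<c' (c-range oβ)

      r'<c⋆ : r' < c ⋆
      r'<c⋆ = <-trans r'<r (r<c⋆ oα)

      c<r'⋆ : c < r' ⋆
      c<r'⋆ = <-trans c<c' (<⋆-swap (r<c⋆ oβ) (c-range oβ))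

      r⋆<r'⋆ : r ⋆ < r' ⋆
      r⋆<r'⋆ = ⋆-antitone r'<r (r-range oα)

      pv-separated : ∀ {L} → ContributionView r' c' L → All (Separated (pv d (r , c))) L
      pv-separated vertical = ≻⇒separated (c'⋆<c⋆ , c<c') ∷ []
      pv-separated (odd-end (high _)) =
        ≻⇒separated (c'⋆<c⋆ , c<c') ∷ ≻⇒separated (r'<c⋆ , c<r'⋆) ∷ []
      pv-separated (odd-end (low _)) =
        ≻⇒separated (r'<c⋆ , c<c') ∷ ≻⇒separated (c'⋆<c⋆ , c<r'⋆) ∷ []

      ph-separated : Disconnected (r , c) (r' , c') →
        ∀ {L} → ContributionView r' c' L → All (Separated (ph d (r , c))) L
      ph-separated (inj₁ r'<r⋆) = separated
        where
        c'<r⋆ : c' < r ⋆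
        c'<r⋆ = <-trans (c<r oβ) r'<r⋆
        r<c'⋆ : r < c' ⋆
        r<c'⋆ = <⋆-swap c'<r⋆ (r-range oα)
        separated : ∀ {L} → ContributionView r' c' L → All (Separated (ph d (r , c))) L
        separated vertical = ≺⇒separated (r<c'⋆ , c'<r⋆) ∷ []
        separated (odd-end (high _)) =
          ≺⇒separated (r<c'⋆ , c'<r⋆) ∷ ≻⇒separated (r'<r , r⋆<r'⋆) ∷ []
        separated (odd-end (low _)) =
          dominates⇒separated r'<r c'<r⋆ r'<r⋆
          ∷ dominated⇒separated r<c'⋆ r⋆<r'⋆ (<⋆-swap r'<r⋆ (r-range oα)) ∷ []
      ph-separated (inj₂ r⋆<c') = separated
        where
        c'⋆<r : c' ⋆ < r
        c'⋆<r = ⋆<-swap r⋆<c' (r-range oα) (c-range oβ)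
        separated : ∀ {L} → ContributionView r' c' L → All (Separated (ph d (r , c))) L
        separated vertical = ≻⇒separated (c'⋆<r , r⋆<c') ∷ []
        separated (odd-end (high _)) =
          ≻⇒separated (c'⋆<r , r⋆<c') ∷ ≻⇒separated (r'<r , r⋆<r'⋆) ∷ []
        separated (odd-end (low _)) =
          ≻⇒separated (r'<r , r⋆<c') ∷ ≻⇒separated (c'⋆<r , r⋆<r'⋆) ∷ []

      low-oddEnd-separated : r < r ⋆ → ∀ {L} → OddEndView r' c' L →
        AllSeparated ((r , c) ∷ sharp d (r , c) ∷ []) L
      low-oddEnd-separated r<r⋆ (high r'⋆<r') = ⊥-elim (<-asym r'⋆<r' (<-trans r'<r r<r'⋆))
        where
        r<r'⋆ : r < r' ⋆
        r<r'⋆ = <-trans r<r⋆ r⋆<r'⋆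
      low-oddEnd-separated r<r⋆ (low _) =
        (≻⇒separated (r'<r , c<c') ∷ dominated⇒separated r<c'⋆ c<r'⋆ r<r'⋆ ∷ [])
        ∷ (dominates⇒separated r'<c⋆ (<-trans (c<r oβ) r'<r⋆) r'<r⋆
           ∷ ≻⇒separated (c'⋆<c⋆ , r⋆<r'⋆) ∷ [])
        ∷ []
        where
        r<r'⋆ : r < r' ⋆
        r<r'⋆ = <-trans r<r⋆ r⋆<r'⋆
        r<c'⋆ : r < c' ⋆
        r<c'⋆ = <-trans r<r'⋆ (⋆-antitone (c<r oβ) (r-range oβ))
        r'<r⋆ : r' < r ⋆
        r'<r⋆ = <-trans r'<r r<r⋆

      oddEnd-separated : ∀ {L u} → OddEndView r c L → Disconnected (r , c) (r' , c') →
        (r < r ⋆ → T u) → AllSeparated L (contribution ((r' , c') , u))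
      oddEnd-separated {u = u} (high _) disc _ =
        pv-separated (contribution-view oβ u) ∷ ph-separated disc (contribution-view oβ u) ∷ []
      oddEnd-separated {u = true} (low r<r⋆) _ _ = low-oddEnd-separated r<r⋆ (oddEnd-view oβ)
      oddEnd-separated {u = false} (low r<r⋆) _ flag = ⊥-elim (flag r<r⋆)

    contributions-separated : ∀ {α β} → InON d v (proj₁ α) → InON d v (proj₁ β) →
      Compatible α β → AllSeparated (contribution α) (contribution β)
    contributions-separated {(_ , _) , false} {(_ , _) , u} oα oβ ((r'<r , c<c') , _ , _) =
      pv-separated (toON oα) (toON oβ) r'<r c<c' (contribution-view (toON oβ) u) ∷ []
    contributions-separated {(_ , _) , true} {(_ , _) , _} oα oβ ((r'<r , c<c') , disc , flag) =
      oddEnd-separated (toON oα) (toON oβ) r'<r c<c' (oddEnd-view (toON oα)) (disc tt) (flag tt)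

    low-flags : ∀ {α} βs → All (InON d v) (α ∷ βs) → AllPairs _≻_ (α ∷ βs) → Low α →
      All (T ∘ proj₂) (markOddEnds α true βs)
    low-flags [] _ _ _ = tt ∷ []
    low-flags {α@(r , c)} (β@(r' , c') ∷ βs) (oα ∷ os) (α≻ ∷ ≻s) r<r⋆
      with connected d α β in eq
    ... | true = ⊥-elim (<-asym (connected⇒⋆< {r} {c} {r'} {c'} eq) (<-trans r'<r r<r⋆))
      where
      r'<r : r' < r
      r'<r = proj₁ (All.head α≻)
    ... | false = tt ∷ low-flags βs os ≻s (low-≻ (toON oα) (All.head α≻) r<r⋆)

    markOddEnds-compatible : ∀ {α} b βs → All (InON d v) (α ∷ βs) → AllPairs _≻_ (α ∷ βs) →
      AllPairs Compatible (markOddEnds α b βs)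
    markOddEnds-compatible b [] _ _ = [] ∷ []
    markOddEnds-compatible {α} b (β ∷ βs) (oα ∷ os) (α≻ ∷ ≻s) with connected d α β in eq
    ... | true =
      markOddEnds-All β (not b) βs (All.map (λ α≻γ _ → α≻γ , (λ ()) , (λ ())) α≻)
      ∷ markOddEnds-compatible (not b) βs os ≻s
    ... | false =
      All.zipWith (λ ((α≻γ , disc) , flag) → α≻γ , (λ _ → disc) , (λ _ → flag))
        (markOddEnds-All β true βs (All.map (λ h _ → h) (All.zip (α≻ , discs))) , flags)
      ∷ markOddEnds-compatible true βs os ≻s
      where
      disc₀ : Disconnected α β
      disc₀ = ¬connected⇒disconnected (toON oα) (toON (All.head os)) eq
      discs : All (Disconnected α) (β ∷ βs)
      discs = disc₀ ∷ All.map (disconnected-≻ {α} {β} disc₀) (AllPairs.head ≻s)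
      flags : All (λ γ → Low α → T (proj₂ γ)) (markOddEnds β true βs)
      flags = All.tabulate λ γ∈ low →
        All.lookup (low-flags βs os ≻s (low-≻ (toON oα) (All.head α≻) low)) γ∈

    S-separated : ∀ C → All (InON d v) C → AllPairs _≻_ C → AllPairs Separated (S d C)
    S-separated [] _ _ = []
    S-separated (α ∷ βs) os ≻s rewrite S≡concatMap-contribution α βs =
      concatMap⁺ (λ {γ} o → contribution-separated (toON o) (proj₂ γ)) contributions-separated
        (markOddEnds-All α true βs (All.map (λ o _ → o) os)) (markOddEnds-compatible true βs os ≻s)

    S-inN : ∀ C → All (InON d v) C → All (InN d v) (S d C)
    S-inN [] _ = []
    S-inN (α ∷ βs) os rewrite S≡concatMap-contribution α βs =
      Allₚ.concat⁺ (Allₚ.map⁺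
        (markOddEnds-All α true βs (All.map (λ o u → contribution-inN (toON o) u) os)))

separated⇒distinguished : ∀ {d v xs} → All (InN d v) xs → AllPairs Separated xs →
  Distinguished d v xs
separated⇒distinguished inN sep =
  inN , λ a∈ b∈ a≢b →
    let (≢s , below , _) = AllPairs-lookup separated-sym sep a∈ b∈ a≢b in ≢s , below

corollary5p6 : (d : ℕ) (v : List ℕ) → InI d v → (C : List Pos) → IsChain d v C →
    Unique (S d C) × Distinguished d v (S d C)
corollary5p6 d v (_ , _ , _ , complementary , _) C (on , linked) =
  AllPairs.map separated⇒≢ separated ,
  separated⇒distinguished {d} {v} (S-inN d v complementary C on) separated
  where
  separated : AllPairs Separated (S d C)
  separated = S-separated d v complementary C on (Linked⇒AllPairs ≻-trans linked)
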